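{- Truth in second-order arithmetic is reducible to $\mathrm{HyperLTL}_S$ model checking, i.e., there is a computable map sending each sentence $\phi$ of second-order arithmetic to a pair $(\mathcal{T},\psi)$ of a finite transition system $\mathcal{T}$ and a $\mathrm{HyperLTL}_S$ sentence $\psi$ such that $(\mathbb{N},+,\cdot,<,\in)\models\phi$ if and only if $\mathrm{Tr}(\mathcal{T})\models\psi$.
   Context: A transition system is $\mathcal{T}=(V,E,I,\ell)$ with finite nonempty $V$, $E\subseteq V\times V$ with every vertex having an outgoing edge, initial vertices $I\subseteq V$, labeling $\ell:V\to2^{\mathrm{AP}}$; $\mathrm{Tr}(\mathcal{T})$ is the set of label sequences $\ell(v_0)\ell(v_1)\cdots$ of runs ($v_0\in I$, consecutive vertices joined by edges). A trace is $\sigma\in(2^{\mathrm{AP}})^\omega$; a pointed trace is $(\sigma,i)$. PLTL/LTL formulas $\theta$ over $\mathrm{AP}$ with standard semantics; past-free means no past operators (yesterday, since). Stuttering: for a finite set $\Gamma$ of past-free PLTL formulas and a trace $\sigma$, $i$ is a proper $\Gamma$-changepoint if $i=0$ or some $\theta\in\Gamma$ has different truth values at $(\sigma,i-1)$ and $(\sigma,i)$; if there are only finitely many, the largest being $i$, then all positions $>i$ are also $\Gamma$-changepoints. $\mathrm{succ}_\Gamma(\sigma,i)=(\sigma,i')$ with $i'$ the least $\Gamma$-changepoint $>i$. $\mathrm{HyperLTL}_S$ (HyperLTL with stuttering): sentences $Q_1x_1\cdots Q_kx_k.\,\psi$ with $Q_j\in\{\exists,\forall\}$ and $\psi::=p_x\mid\neg\psi\mid\psi\vee\psi\mid\mathbf{X}_\Gamma\psi\mid\psi\,\mathbf{U}_\Gamma\,\psi$,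 $\Gamma$ finite sets of past-free PLTL formulas. For a set $\mathcal{L}$ of traces, quantifiers range over $\sigma\in\mathcal{L}$ binding $x$ to $(\sigma,0)$; $p_x$ holds iff $\Pi(x)=(\sigma,i)$ and $p\in\sigma(i)$; $\mathbf{X}_\Gamma\psi$ holds iff $\psi$ holds at the assignment obtained by applying $\mathrm{succ}_\Gamma$ to every $\Pi(x)$; $\psi_1\mathbf{U}_\Gamma\psi_2$ holds iff for some $i$, $\psi_2$ holds at the $i$-fold such update and $\psi_1$ at all $j$-fold updates with $j<i$. $\mathcal{L}\models\psi$ is satisfaction with the empty initial assignment. Truth in second-order arithmetic: given a sentence of second-order arithmetic over signature $(+,\cdot,<,\in)$ (quantification over natural numbers and over sets of natural numbers), decide whether it holds in $(\mathbb{N},+,\cdot,<,\in)$. -}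

module Defs where

open import Level using (0ℓ)
open import Data.Nat using (ℕ; zero; suc; _+_; _*_; _<_; _≤_)
open import Data.Fin using (Fin)
open import Data.Bool using (Bool; true; false)
open import Data.List using (List)
open import Data.List.Membership.Propositional using (_∈_)
open import Data.Product using (Σ; ∃; _×_; _,_)
open import Data.Sum using (_⊎_)
open import Data.Empty using (⊥)
open import Data.Unit using (⊤)
open import Relation.Nullary using (¬_)
open import Relation.Binary.PropositionalEquality using (_≡_)
open import Function.Bundles using (_⇔_)

-- Second-order arithmetic over the signature (+, ·, <, ∈)
-- n = number of first-order (number) variables in scope,
-- m = number of second-order (set) variables in scope (de Bruijn).

data Term (n : ℕ) : Set where
  var  : Fin n → Term n
  _⊕_  : Term n → Term n → Term n
  _⊗_  : Term n → Term n → Term n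

data SOFormula (n m : ℕ) : Set where
  _≐_   : Term n → Term n → SOFormula n m
  _≺_   : Term n → Term n → SOFormula n m
  _∈ₛ_  : Term n → Fin m → SOFormula n m
  ¬ₛ_   : SOFormula n m → SOFormula n m
  _∨ₛ_  : SOFormula n m → SOFormula n m → SOFormula n m
  _∧ₛ_  : SOFormula n m → SOFormula n m → SOFormula n m
  ∃₁ ∀₁ : SOFormula (suc n) m → SOFormula n m
  ∃₂ ∀₂ : SOFormula n (suc m) → SOFormula n m

SOSentence : Set
SOSentence = SOFormula 0 0

NSet : Set
NSet = ℕ → Bool

ext : {A : Set} {n : ℕ} → A → (Fin n → A) → Fin (suc n) → A
ext a ρ Fin.zero    = a
ext a ρ (Fin.suc i) = ρ i

evalT : {n : ℕ} → (Fin n → ℕ) → Term n → ℕ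
evalT ρ (var x) = ρ x
evalT ρ (s ⊕ t) = evalT ρ s + evalT ρ t
evalT ρ (s ⊗ t) = evalT ρ s * evalT ρ t

⟦_⟧SO : {n m : ℕ} → SOFormula n m → (Fin n → ℕ) → (Fin m → NSet) → Set
⟦ s ≐ t ⟧SO ρ η  = evalT ρ s ≡ evalT ρ t
⟦ s ≺ t ⟧SO ρ η  = evalT ρ s < evalT ρ t
⟦ t ∈ₛ X ⟧SO ρ η = η X (evalT ρ t) ≡ true
⟦ ¬ₛ φ ⟧SO ρ η   = ¬ ⟦ φ ⟧SO ρ η
⟦ φ ∨ₛ ψ ⟧SO ρ η = ⟦ φ ⟧SO ρ η ⊎ ⟦ ψ ⟧SO ρ η
⟦ φ ∧ₛ ψ ⟧SO ρ η = ⟦ φ ⟧SO ρ η × ⟦ ψ ⟧SO ρ η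
⟦ ∃₁ φ ⟧SO ρ η   = Σ ℕ λ a → ⟦ φ ⟧SO (ext a ρ) η
⟦ ∀₁ φ ⟧SO ρ η   = (a : ℕ) → ⟦ φ ⟧SO (ext a ρ) η
⟦ ∃₂ φ ⟧SO ρ η   = Σ NSet λ X → ⟦ φ ⟧SO ρ (ext X η)
⟦ ∀₂ φ ⟧SO ρ η   = (X : NSet) → ⟦ φ ⟧SO ρ (ext X η)

noVar : {A : Set} → Fin 0 → A
noVar ()

TrueInN : SOSentence → Set
TrueInN φ = ⟦ φ ⟧SO noVar noVar

Label : ℕ → Set
Label k = Fin k → Bool

Trace : ℕ → Set
Trace k = ℕ → Label k

data LTL (k : ℕ) : Set where
  atom : Fin k → LTL k
  ¬ₗ_  : LTL k → LTL k
  _∨ₗ_ : LTL k → LTL k → LTL k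
  Xₗ   : LTL k → LTL k
  _Uₗ_ : LTL k → LTL k → LTL k

_⊨ₗ_ : {k : ℕ} → (Trace k × ℕ) → LTL k → Set
(σ , i) ⊨ₗ atom p   = σ i p ≡ true
(σ , i) ⊨ₗ (¬ₗ θ)   = ¬ ((σ , i) ⊨ₗ θ)
(σ , i) ⊨ₗ (θ ∨ₗ χ) = ((σ , i) ⊨ₗ θ) ⊎ ((σ , i) ⊨ₗ χ)
(σ , i) ⊨ₗ Xₗ θ     = (σ , suc i) ⊨ₗ θ
(σ , i) ⊨ₗ (θ Uₗ χ) =
  Σ ℕ λ j → i ≤ j × ((σ , j) ⊨ₗ χ) × ((l : ℕ) → i ≤ l → l < j → (σ , l) ⊨ₗ θ)

ProperCP : {k : ℕ} → List (LTL k) → Trace k → ℕ → Set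
ProperCP Γ σ zero    = ⊤
ProperCP Γ σ (suc i) =
  Σ (LTL _) λ θ → θ ∈ Γ ×
    ((((σ , i) ⊨ₗ θ) × ¬ ((σ , suc i) ⊨ₗ θ)) ⊎ (¬ ((σ , i) ⊨ₗ θ) × ((σ , suc i) ⊨ₗ θ)))

CP : {k : ℕ} → List (LTL k) → Trace k → ℕ → Set
CP Γ σ i = ProperCP Γ σ i
         ⊎ Σ ℕ λ m → ProperCP Γ σ m × m < i × ((j : ℕ) → m < j → ¬ ProperCP Γ σ j)

Succ : {k : ℕ} → List (LTL k) → Trace k → ℕ → ℕ → Set
Succ Γ σ i i' = CP Γ σ i' × i < i' × ((j : ℕ) → i < j → j < i' → ¬ CP Γ σ j)

-- HyperLTL_S
-- k = |AP|, v = number of trace variables in scope (de Bruijn)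

data HBody (k v : ℕ) : Set where
  atomₕ : Fin k → Fin v → HBody k v
  ¬ₕ_   : HBody k v → HBody k v
  _∨ₕ_  : HBody k v → HBody k v → HBody k v
  Xₕ    : List (LTL k) → HBody k v → HBody k v
  Uₕ    : List (LTL k) → HBody k v → HBody k v → HBody k v

data HFormula (k : ℕ) : ℕ → Set where
  body : {v : ℕ} → HBody k v → HFormula k v
  ∃ₕ ∀ₕ : {v : ℕ} → HFormula k (suc v) → HFormula k v

HSentence : ℕ → Set
HSentence k = HFormula k 0

Step : {k v : ℕ} → List (LTL k) → (Fin v → Trace k) → (Fin v → ℕ) → (Fin v → ℕ) → Set
Step Γ tr pos pos' = (x : Fin _) → Succ Γ (tr x) (pos x) (pos' x)

data Iter {k v : ℕ} (Γ : List (LTL k)) (tr : Fin v → Trace k)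
     : ℕ → (Fin v → ℕ) → (Fin v → ℕ) → Set where
  iz : {pos pos' : Fin v → ℕ} → ((x : Fin v) → pos x ≡ pos' x) → Iter Γ tr zero pos pos'
  is : {n : ℕ} {pos mid pos' : Fin v → ℕ} →
       Step Γ tr pos mid → Iter Γ tr n mid pos' → Iter Γ tr (suc n) pos pos'

SatB : {k v : ℕ} → (Fin v → Trace k) → HBody k v → (Fin v → ℕ) → Set
SatB tr (atomₕ p x) pos = tr x (pos x) p ≡ true
SatB tr (¬ₕ ψ) pos      = ¬ SatB tr ψ pos
SatB tr (ψ ∨ₕ χ) pos    = SatB tr ψ pos ⊎ SatB tr χ pos
SatB tr (Xₕ Γ ψ) pos    = Σ (Fin _ → ℕ) λ pos' → Step Γ tr pos pos' × SatB tr ψ pos'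
SatB tr (Uₕ Γ ψ χ) pos  =
  Σ ℕ λ n → Σ (Fin _ → ℕ) λ posn → Iter Γ tr n pos posn × SatB tr χ posn ×
    ((j : ℕ) (posj : Fin _ → ℕ) → j < n → Iter Γ tr j pos posj → SatB tr ψ posj)

SatH : {k v : ℕ} → (Trace k → Set) → HFormula k v → (Fin v → Trace k) → Set
SatH L (body ψ) tr = SatB tr ψ (λ _ → 0)
SatH L (∃ₕ φ) tr   = Σ (Trace _) λ σ → L σ × SatH L φ (ext σ tr)
SatH L (∀ₕ φ) tr   = (σ : Trace _) → L σ → SatH L φ (ext σ tr)

_⊨ₕ_ : {k : ℕ} → (Trace k → Set) → HSentence k → Set
L ⊨ₕ φ = SatH L φ noVar

record TS (k : ℕ) : Set where
  field
    n     : ℕ                          -- |V| = suc n (nonempty)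
    E     : Fin (suc n) → Fin (suc n) → Bool
    I     : Fin (suc n) → Bool
    ℓ     : Fin (suc n) → Label k
    total : (u : Fin (suc n)) → Σ (Fin (suc n)) λ w → E u w ≡ true

Tr : {k : ℕ} → TS k → Trace k → Set
Tr T σ = Σ (ℕ → Fin (suc n)) λ r →
           I (r 0) ≡ true × ((i : ℕ) → E (r i) (r (suc i)) ≡ true)
           × ((i : ℕ) (p : Fin _) → σ i p ≡ ℓ (r i) p)
  where open TS T

record MCInstance : Set where
  constructor mc
  field
    k   : ℕ
    sys : TS k
    ψ   : HSentence k

Holds : MCInstance → Set
Holds (mc k T ψ) = Tr T ⊨ₕ ψ

{-# OPTIONS --safe #-}
-- Every trace over the atoms mark, phase and prefix is a run of the complete transition
-- system on all 2³ labels, so trace quantifiers range over all traces. A number a is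
-- encoded by a trace whose mark holds exactly at position a, a set by the positions of
-- mark; number quantifiers are relativised to such numerals, set quantifiers are plain.
-- Equality, order and membership are LTL properties of synchronously advancing traces.
-- Arithmetic uses stuttering: if prefix holds exactly on [0, a], X_prefix moves that
-- trace to a + 1 while numerals move to 1, which turns a + b = c into a comparison of
-- marks; if phase is true on [0, a) and flips every a steps, F_phase moves that trace
-- in strides of a while numerals move by 1, so it is at b · a when a numeral is at b.
-- Finally the formula is brought to prenex form, which is classically equivalent.
module Submission where

open import Defs
open import Level using (0ℓ)
open import Axiom.ExcludedMiddle using (ExcludedMiddle)
open import Axiom.DoubleNegationElimination using (em⇒dne)
open import Data.Bool using (Bool; true; false; not)
open import Data.Bool.Properties using (¬-not; not-¬)
open import Data.Empty using (⊥-elim)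
open import Data.Fin using (Fin; zero; suc; cast; finToFun; funToFin)
open import Data.Fin.Properties using (2↔Bool; cast-involutive; finToFun-funToFin)
open import Data.List using (List; []; _∷_)
open import Data.List.Relation.Unary.Any using (here)
open import Data.Nat using (ℕ; zero; suc; pred; _+_; _*_; _^_; _∸_; _/_; _<_; _≤_; z≤n; s≤s; _≟_; _≤?_)
open import Data.Nat.DivMod using (m<n⇒m/n≡0; m/n≡1+[m∸n]/n)
open import Data.Nat.GeneralisedArithmetic using (iterate)
open import Data.Nat.Induction using (<-rec)
open import Data.Nat.Properties
open import Data.Product using (Σ; ∃; _×_; _,_; proj₁; proj₂)
open import Data.Product.Function.NonDependent.Propositional using (_×-⇔_)
open import Data.Sum using (_⊎_; inj₁; inj₂; [_,_]′; fromInj₁; swap)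
open import Data.Sum.Function.Propositional using (_⊎-⇔_)
open import Data.Unit using (tt)
open import Function.Base using (_∘_)
open import Function.Bundles using (_⇔_; mk⇔; Equivalence; Inverse)
open import Function.Properties.Equivalence using () renaming (refl to ⇔-refl; sym to ⇔-sym; trans to ⇔-trans)
open import Function.Related.Propositional using (equivalence)
open import Function.Related.TypeIsomorphisms using (¬-cong-⇔; →-cong-⇔; Related-cong)
open import Relation.Binary.Definitions using (tri<; tri≈; tri>)
open import Relation.Binary.PropositionalEquality
open import Relation.Nullary using (¬_; Dec; yes; no; does)
open import Relation.Nullary.Decidable using (toSum)
open import Relation.Nullary.Negation using (¬∃⟶∀¬; ∀¬⟶¬∃)
open import Relation.Unary using (Decidable)

open Equivalence using (to; from)

Π-cong-⇔ : {X : Set} {A B : X → Set} → (∀ x → A x ⇔ B x) → ((x : X) → A x) ⇔ ((x : X) → B x)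
Π-cong-⇔ A⇔B = mk⇔ (λ f x → to (A⇔B x) (f x)) (λ g x → from (A⇔B x) (g x))

Σ-cong-⇔ : {X : Set} {A B : X → Set} → (∀ x → A x ⇔ B x) → Σ X A ⇔ Σ X B
Σ-cong-⇔ A⇔B = mk⇔ (λ (x , a) → x , to (A⇔B x) a) (λ (x , b) → x , from (A⇔B x) b)

⇔-cong-⇔ : {A B C D : Set} → A ⇔ B → C ⇔ D → (A ⇔ C) ⇔ (B ⇔ D)
⇔-cong-⇔ = Related-cong {k = equivalence}

U-cong-⇔ : {A B C D : ℕ → Set} → (∀ n → A n ⇔ B n) → (∀ n → C n ⇔ D n) →
           (Σ ℕ λ n → A n × (∀ j → j < n → C j)) ⇔ (Σ ℕ λ n → B n × (∀ j → j < n → D j))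
U-cong-⇔ A⇔B C⇔D = Σ-cong-⇔ λ n → A⇔B n ×-⇔ Π-cong-⇔ λ j → Π-cong-⇔ λ _ → C⇔D j

Σ-⊎ˡ : {X : Set} {A : X → Set} {B : Set} → X → Σ X (λ x → A x ⊎ B) ⇔ (Σ X A ⊎ B)
Σ-⊎ˡ x₀ = mk⇔ (λ { (x , inj₁ a) → inj₁ (x , a) ; (_ , inj₂ b) → inj₂ b })
              (λ { (inj₁ (x , a)) → x , inj₁ a ; (inj₂ b) → x₀ , inj₂ b })

one-point : {P : ℕ → Set} {a : ℕ} → (Σ ℕ λ n → n ≡ a × P n) ⇔ P a
one-point = mk⇔ (λ { (_ , refl , p) → p }) (λ p → _ , refl , p)

one-point′ : {P : ℕ → Set} {a : ℕ} → (Σ ℕ λ n → a ≡ n × P n) ⇔ P a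
one-point′ = mk⇔ (λ { (_ , refl , p) → p }) (λ p → _ , refl , p)

one-point₂ : {R : ℕ → ℕ → Set} {a b : ℕ} → (Σ ℕ λ m → Σ ℕ λ n → a ≡ m × b ≡ n × R m n) ⇔ R a b
one-point₂ = mk⇔ (λ { (_ , _ , refl , refl , r) → r }) (λ r → _ , _ , refl , refl , r)

does-⇔ : {A : Set} (a? : Dec A) → does a? ≡ true ⇔ A
does-⇔ (yes a) = mk⇔ (λ _ → a) (λ _ → refl)
does-⇔ (no ¬a) = mk⇔ (λ ()) (⊥-elim ∘ ¬a)

¬true⇔false : ∀ {b} → (¬ b ≡ true) ⇔ (b ≡ false)
¬true⇔false = mk⇔ ¬-not not-¬

≡not⇔ : ∀ {b c} → (c ≡ not b) ⇔ (b ≡ true ⇔ (¬ c ≡ true))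
≡not⇔ = mk⇔ to′ from′
  where
  to′ : ∀ {b c} → c ≡ not b → (b ≡ true ⇔ (¬ c ≡ true))
  to′ {true}  refl = mk⇔ (λ _ ()) (λ _ → refl)
  to′ {false} refl = mk⇔ (λ ()) (λ ¬t → ⊥-elim (¬t refl))
  from′ : ∀ {b c} → (b ≡ true ⇔ (¬ c ≡ true)) → c ≡ not b
  from′ {true}  {true}  e = ⊥-elim (to e refl refl)
  from′ {true}  {false} e = refl
  from′ {false} {true}  e = refl
  from′ {false} {false} e = ⊥-elim (not-¬ refl (from e (λ ())))

least-witness : {P : ℕ → Set} → Decidable P → ∀ {n} → P n → Σ ℕ λ m → P m × (∀ {j} → j < m → ¬ P j)
least-witness {P} P? {n} = <-rec (λ n → P n → Σ ℕ λ m → P m × (∀ {j} → j < m → ¬ P j)) search n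
  where
  search : ∀ n → (∀ {m} → m < n → P m → Σ ℕ λ m → P m × (∀ {j} → j < m → ¬ P j)) →
           P n → Σ ℕ λ m → P m × (∀ {j} → j < m → ¬ P j)
  search n below pn with anyUpTo? P? n
  ... | yes (j , j<n , pj) = below j<n pj
  ... | no none            = n , pn , λ j<n pj → none (_ , j<n , pj)

last-witness : {P : ℕ → Set} → Decidable P → P 0 → ∀ n →
               Σ ℕ λ m → m ≤ n × P m × (∀ j → m < j → j ≤ n → ¬ P j)
last-witness P? p0 zero = 0 , z≤n , p0 , λ j 0<j j≤0 _ → <⇒≱ 0<j j≤0
last-witness {P} P? p0 (suc n) with P? (suc n) | last-witness P? p0 n
... | yes pn | _ = suc n , ≤-refl , pn , λ j n<j j≤n _ → <⇒≱ n<j j≤n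
... | no ¬pn | m , m≤n , pm , gap = m , m≤n⇒m≤1+n m≤n , pm , gap′
  where
  gap′ : ∀ j → m < j → j ≤ suc n → ¬ P j
  gap′ j m<j j≤1+n with m≤n⇒m<n∨m≡n j≤1+n
  ... | inj₁ j<1+n = gap j m<j (≤-pred j<1+n)
  ... | inj₂ refl  = ¬pn

module Classical (em : ExcludedMiddle 0ℓ) where

  dne : {A : Set} → ¬ ¬ A → A
  dne = em⇒dne em

  ¬Π⇔Σ¬ : {X : Set} {A : X → Set} → (¬ ((x : X) → A x)) ⇔ Σ X (λ x → ¬ A x)
  ¬Π⇔Σ¬ = mk⇔ (λ ¬∀ → dne λ ¬∃ → ¬∀ λ x → dne λ ¬a → ¬∃ (x , ¬a)) (λ (x , ¬a) f → ¬a (f x))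

  Π-⊎ˡ : {X : Set} {A : X → Set} {B : Set} → ((x : X) → A x ⊎ B) ⇔ (((x : X) → A x) ⊎ B)
  Π-⊎ˡ {X} {A} {B} = mk⇔ split (λ { (inj₁ f) x → inj₁ (f x) ; (inj₂ b) _ → inj₂ b })
    where
    split : ((x : X) → A x ⊎ B) → ((x : X) → A x) ⊎ B
    split f with em {B}
    ... | yes b = inj₂ b
    ... | no ¬b = inj₁ λ x → fromInj₁ (⊥-elim ∘ ¬b) (f x)

  ¬⊎¬⇔× : {A B : Set} → (¬ (¬ A ⊎ ¬ B)) ⇔ (A × B)
  ¬⊎¬⇔× = mk⇔ (λ h → dne (h ∘ inj₁) , dne (h ∘ inj₂))
              (λ { (a , b) (inj₁ ¬a) → ¬a a ; (a , b) (inj₂ ¬b) → ¬b b })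

  ¬⊎⇔→ : {A B : Set} → (¬ A ⊎ B) ⇔ (A → B)
  ¬⊎⇔→ = mk⇔ (λ { (inj₁ ¬a) a → ⊥-elim (¬a a) ; (inj₂ b) _ → b }) (λ f → [ inj₂ ∘ f , inj₁ ]′ (toSum em))

module _ {k : ℕ} {Γ : List (LTL k)} {σ : Trace k} where

  Succ-unique : ∀ {i a b} → Succ Γ σ i a → Succ Γ σ i b → a ≡ b
  Succ-unique {a = a} {b} (cpa , i<a , gapa) (cpb , i<b , gapb) with <-cmp a b
  ... | tri< a<b _ _ = ⊥-elim (gapb a i<a a<b cpa)
  ... | tri≈ _ a≡b _ = a≡b
  ... | tri> _ _ b<a = ⊥-elim (gapa b i<b b<a cpb)

  -- A changepoint of the stuttering tail lies beyond every proper changepoint.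
  Succ-proper : ∀ {i i′} → i < i′ → ProperCP Γ σ i′ → (∀ j → i < j → j < i′ → ¬ ProperCP Γ σ j) →
                Succ Γ σ i i′
  Succ-proper {i} {i′} i<i′ p gap = inj₁ p , i<i′ , no-cp
    where
    no-cp : ∀ j → i < j → j < i′ → ¬ CP Γ σ j
    no-cp j i<j j<i′ (inj₁ pj)                   = gap j i<j j<i′ pj
    no-cp j i<j j<i′ (inj₂ (_ , _ , m<j , none)) = none _ (<-trans m<j j<i′) p

  Succ-after-last : ∀ {i m} → ProperCP Γ σ m → m ≤ i → (∀ j → m < j → ¬ ProperCP Γ σ j) →
                    Succ Γ σ i (suc i)
  Succ-after-last pm m≤i none =
    inj₂ (_ , pm , s≤s m≤i , none) , ≤-refl , λ j i<j j≤i _ → <⇒≱ i<j (≤-pred j≤i)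

  Succ-stable : (∀ j → ¬ ProperCP Γ σ (suc j)) → ∀ i → Succ Γ σ i (suc i)
  Succ-stable stable i = Succ-after-last tt z≤n λ { (suc j) _ → stable j }

Succ-[] : ∀ {k} {σ : Trace k} i → Succ [] σ i (suc i)
Succ-[] = Succ-stable λ j ()

module _ {k : ℕ} {σ : Trace k} {p : Fin k} where

  ProperCP-atom : ∀ {i} → ProperCP (atom p ∷ []) σ (suc i) ⇔ (σ i p ≢ σ (suc i) p)
  ProperCP-atom {i} = mk⇔ changed (λ ne → atom p , here refl , bit-flip ne)
    where
    changed : ProperCP (atom p ∷ []) σ (suc i) → σ i p ≢ σ (suc i) p
    changed (_ , here refl , inj₁ (b , ¬b′)) eq = ¬b′ (trans (sym eq) b)
    changed (_ , here refl , inj₂ (¬b , b′)) eq = ¬b (trans eq b′)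
    bit-flip : ∀ {b c} → b ≢ c → (b ≡ true × c ≢ true) ⊎ (b ≢ true × c ≡ true)
    bit-flip {true}  {true}  ne = ⊥-elim (ne refl)
    bit-flip {true}  {false} ne = inj₁ (refl , λ ())
    bit-flip {false} {true}  ne = inj₂ ((λ ()) , refl)
    bit-flip {false} {false} ne = ⊥-elim (ne refl)

  Succ-atom-constant : ∀ {b} → (∀ j → σ j p ≡ b) → ∀ i → Succ (atom p ∷ []) σ i (suc i)
  Succ-atom-constant const = Succ-stable λ j pc → to ProperCP-atom pc (trans (const j) (sym (const (suc j))))

  Succ-atom-block : ∀ {i l b} → i < l → (∀ j → i ≤ j → j < l → σ j p ≡ b) → σ l p ≢ b →
                    Succ (atom p ∷ []) σ i l
  Succ-atom-block {i} {suc l} {b} i<l block end = Succ-proper i<l proper-end gap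
    where
    proper-end : ProperCP (atom p ∷ []) σ (suc l)
    proper-end = from ProperCP-atom λ eq → end (trans (sym eq) (block l (≤-pred i<l) ≤-refl))
    gap : ∀ j → i < j → j < suc l → ¬ ProperCP (atom p ∷ []) σ j
    gap (suc j) i<j j<l pc = to ProperCP-atom pc (trans (block j (≤-pred i<j) (<-trans ≤-refl j<l))
                                                        (sym (block (suc j) (<⇒≤ i<j) j<l)))

renameᴮ : ∀ {k v w} → (Fin v → Fin w) → HBody k v → HBody k w
renameᴮ ρ (atomₕ p x) = atomₕ p (ρ x)
renameᴮ ρ (¬ₕ ψ)      = ¬ₕ renameᴮ ρ ψ
renameᴮ ρ (ψ ∨ₕ χ)    = renameᴮ ρ ψ ∨ₕ renameᴮ ρ χ
renameᴮ ρ (Xₕ Γ ψ)    = Xₕ Γ (renameᴮ ρ ψ)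
renameᴮ ρ (Uₕ Γ ψ χ)  = Uₕ Γ (renameᴮ ρ ψ) (renameᴮ ρ χ)

module Stuttering (em : ExcludedMiddle 0ℓ) where

  Succ-exists : ∀ {k} (Γ : List (LTL k)) σ i → ∃ (Succ Γ σ i)
  Succ-exists Γ σ i with em {∃ λ j → i < j × ProperCP Γ σ j}
  ... | yes (j , later) with least-witness {λ j → i < j × ProperCP Γ σ j} (λ _ → em) later
  ...   | m , (i<m , pm) , earlier = m , Succ-proper i<m pm λ j i<j j<m pj → earlier j<m (i<j , pj)
  Succ-exists Γ σ i | no none with last-witness {ProperCP Γ σ} (λ _ → em) tt i
  ...   | m , m≤i , pm , gap = suc i , Succ-after-last pm m≤i beyond
    where
    beyond : ∀ j → m < j → ¬ ProperCP Γ σ j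
    beyond j m<j pj with j ≤? i
    ... | yes j≤i = gap j m<j j≤i pj
    ... | no j≰i  = none (j , ≰⇒> j≰i , pj)

  module _ {k : ℕ} where

    succ : List (LTL k) → Trace k → ℕ → ℕ
    succ Γ σ i = proj₁ (Succ-exists Γ σ i)

    succ-Succ : ∀ Γ σ i → Succ Γ σ i (succ Γ σ i)
    succ-Succ Γ σ i = proj₂ (Succ-exists Γ σ i)

    succ-≡ : ∀ {Γ σ i j} → Succ Γ σ i j → succ Γ σ i ≡ j
    succ-≡ = Succ-unique (succ-Succ _ _ _)

    succⁿ-≡-+ : ∀ {Γ σ} → (∀ i → Succ Γ σ i (suc i)) → ∀ n i → iterate (succ Γ σ) i n ≡ i + n
    succⁿ-≡-+ unit zero    i = sym (+-identityʳ i)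
    succⁿ-≡-+ unit (suc n) i = begin
      iterate (succ _ _) (succ _ _ i) n ≡⟨ cong (λ i′ → iterate (succ _ _) i′ n) (succ-≡ (unit i)) ⟩
      iterate (succ _ _) (suc i) n      ≡⟨ succⁿ-≡-+ unit n (suc i) ⟩
      suc i + n                         ≡⟨ +-suc i n ⟨
      i + suc n                         ∎
      where open ≡-Reasoning

    succ-atom-constant : ∀ {σ p b} → (∀ j → σ j p ≡ b) → ∀ i → succ (atom p ∷ []) σ i ≡ suc i
    succ-atom-constant const i = succ-≡ (Succ-atom-constant const i)

    succ-atom-prefix : ∀ {σ p a} → (∀ n → σ n p ≡ true ⇔ n ≤ a) → succ (atom p ∷ []) σ 0 ≡ suc a
    succ-atom-prefix prefix-iff = succ-≡ (Succ-atom-block (s≤s z≤n) (λ j _ j≤a → from (prefix-iff j) (≤-pred j≤a))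
                                                          (λ end → 1+n≰n (to (prefix-iff _) end)))

    module _ {v : ℕ} where

      step : List (LTL k) → (Fin v → Trace k) → (Fin v → ℕ) → Fin v → ℕ
      step Γ tr pos x = succ Γ (tr x) (pos x)

      steps : List (LTL k) → (Fin v → Trace k) → ℕ → (Fin v → ℕ) → Fin v → ℕ
      steps Γ tr n pos x = iterate (succ Γ (tr x)) (pos x) n

      Sat : (Fin v → Trace k) → HBody k v → (Fin v → ℕ) → Set
      Sat tr (atomₕ p x) pos = tr x (pos x) p ≡ true
      Sat tr (¬ₕ ψ)      pos = ¬ Sat tr ψ pos
      Sat tr (ψ ∨ₕ χ)    pos = Sat tr ψ pos ⊎ Sat tr χ pos
      Sat tr (Xₕ Γ ψ)    pos = Sat tr ψ (step Γ tr pos)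
      Sat tr (Uₕ Γ ψ χ)  pos =
        Σ ℕ λ n → Sat tr χ (steps Γ tr n pos) × (∀ j → j < n → Sat tr ψ (steps Γ tr j pos))

      Sat-cong : ∀ ψ {tr tr′ pos pos′} → tr ≗ tr′ → pos ≗ pos′ → Sat tr ψ pos ⇔ Sat tr′ ψ pos′
      Sat-cong (atomₕ p x) tr≗ pos≗ rewrite tr≗ x | pos≗ x = ⇔-refl
      Sat-cong (¬ₕ ψ)      tr≗ pos≗ = ¬-cong-⇔ (Sat-cong ψ tr≗ pos≗)
      Sat-cong (ψ ∨ₕ χ)    tr≗ pos≗ = Sat-cong ψ tr≗ pos≗ ⊎-⇔ Sat-cong χ tr≗ pos≗
      Sat-cong (Xₕ Γ ψ)    tr≗ pos≗ = Sat-cong ψ tr≗ λ x → cong₂ (succ Γ) (tr≗ x) (pos≗ x)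
      Sat-cong (Uₕ Γ ψ χ) {tr} {tr′} {pos} {pos′} tr≗ pos≗ =
        U-cong-⇔ (λ n → Sat-cong χ tr≗ (steps≗ n)) (λ n → Sat-cong ψ tr≗ (steps≗ n))
        where
        steps≗ : ∀ n → steps Γ tr n pos ≗ steps Γ tr′ n pos′
        steps≗ n x = cong₂ (λ σ i → iterate (succ Γ σ) i n) (tr≗ x) (pos≗ x)

      Step⇒≗step : ∀ {Γ tr pos pos′} → Step Γ tr pos pos′ → pos′ ≗ step Γ tr pos
      Step⇒≗step st x = sym (succ-≡ (st x))

      Iter⇒≗steps : ∀ {Γ tr n pos pos′} → Iter Γ tr n pos pos′ → pos′ ≗ steps Γ tr n pos
      Iter⇒≗steps (iz pos≗)  x = sym (pos≗ x)
      Iter⇒≗steps {Γ} {tr} {suc n} (is st it) x =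
        trans (Iter⇒≗steps it x) (cong (λ i → iterate (succ Γ (tr x)) i n) (Step⇒≗step st x))

      steps-Iter : ∀ Γ tr n pos → Iter Γ tr n pos (steps Γ tr n pos)
      steps-Iter Γ tr zero    pos = iz λ _ → refl
      steps-Iter Γ tr (suc n) pos = is (λ x → succ-Succ Γ (tr x) (pos x)) (steps-Iter Γ tr n (step Γ tr pos))

      SatB⇔Sat : ∀ ψ tr pos → SatB tr ψ pos ⇔ Sat tr ψ pos
      SatB⇔Sat (atomₕ p x) tr pos = ⇔-refl
      SatB⇔Sat (¬ₕ ψ)      tr pos = ¬-cong-⇔ (SatB⇔Sat ψ tr pos)
      SatB⇔Sat (ψ ∨ₕ χ)    tr pos = SatB⇔Sat ψ tr pos ⊎-⇔ SatB⇔Sat χ tr pos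
      SatB⇔Sat (Xₕ Γ ψ)    tr pos = mk⇔
        (λ (pos′ , st , sat) → to (Sat-cong ψ (λ _ → refl) (Step⇒≗step st)) (to (SatB⇔Sat ψ tr pos′) sat))
        (λ sat → step Γ tr pos , (λ x → succ-Succ Γ (tr x) (pos x)) , from (SatB⇔Sat ψ tr _) sat)
      SatB⇔Sat (Uₕ Γ ψ χ)  tr pos = mk⇔
        (λ (n , posₙ , it , χₙ , ψ<n) →
           n , to (Sat-cong χ (λ _ → refl) (Iter⇒≗steps it)) (to (SatB⇔Sat χ tr posₙ) χₙ) ,
           λ j j<n → to (SatB⇔Sat ψ tr _) (ψ<n j _ j<n (steps-Iter Γ tr j pos)))
        (λ (n , χₙ , ψ<n) →
           n , steps Γ tr n pos , steps-Iter Γ tr n pos , from (SatB⇔Sat χ tr _) χₙ ,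
           λ j posⱼ j<n it → from (SatB⇔Sat ψ tr posⱼ) (from (Sat-cong ψ (λ _ → refl) (Iter⇒≗steps it)) (ψ<n j j<n)))

    Sat-renameᴮ : ∀ {v w} (ρ : Fin v → Fin w) ψ tr pos →
                  Sat tr (renameᴮ ρ ψ) pos ⇔ Sat (tr ∘ ρ) ψ (pos ∘ ρ)
    Sat-renameᴮ ρ (atomₕ p x) tr pos = ⇔-refl
    Sat-renameᴮ ρ (¬ₕ ψ)      tr pos = ¬-cong-⇔ (Sat-renameᴮ ρ ψ tr pos)
    Sat-renameᴮ ρ (ψ ∨ₕ χ)    tr pos = Sat-renameᴮ ρ ψ tr pos ⊎-⇔ Sat-renameᴮ ρ χ tr pos
    Sat-renameᴮ ρ (Xₕ Γ ψ)    tr pos = Sat-renameᴮ ρ ψ tr (step Γ tr pos)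
    Sat-renameᴮ ρ (Uₕ Γ ψ χ)  tr pos =
      U-cong-⇔ (λ n → Sat-renameᴮ ρ χ tr (steps Γ tr n pos)) (λ n → Sat-renameᴮ ρ ψ tr (steps Γ tr n pos))

renameᴴ : ∀ {k v w} → (Fin v → Fin w) → HFormula k v → HFormula k w
renameᴴ ρ (body ψ) = body (renameᴮ ρ ψ)
renameᴴ ρ (∃ₕ φ)   = ∃ₕ (renameᴴ (ext zero (suc ∘ ρ)) φ)
renameᴴ ρ (∀ₕ φ)   = ∀ₕ (renameᴴ (ext zero (suc ∘ ρ)) φ)

negᴴ : ∀ {k v} → HFormula k v → HFormula k v
negᴴ (body ψ) = body (¬ₕ ψ)
negᴴ (∃ₕ φ)   = ∀ₕ (negᴴ φ)
negᴴ (∀ₕ φ)   = ∃ₕ (negᴴ φ)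

orᴴᴮ : ∀ {k v} → HFormula k v → HBody k v → HFormula k v
orᴴᴮ (body ψ) χ = body (ψ ∨ₕ χ)
orᴴᴮ (∃ₕ φ)   χ = ∃ₕ (orᴴᴮ φ (renameᴮ suc χ))
orᴴᴮ (∀ₕ φ)   χ = ∀ₕ (orᴴᴮ φ (renameᴮ suc χ))

orᴴ : ∀ {k v} → HFormula k v → HFormula k v → HFormula k v
orᴴ (body ψ) φ′ = orᴴᴮ φ′ ψ
orᴴ (∃ₕ φ)   φ′ = ∃ₕ (orᴴ φ (renameᴴ suc φ′))
orᴴ (∀ₕ φ)   φ′ = ∀ₕ (orᴴ φ (renameᴴ suc φ′))

andᴴ : ∀ {k v} → HFormula k v → HFormula k v → HFormula k v
andᴴ φ φ′ = negᴴ (orᴴ (negᴴ φ) (negᴴ φ′))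

infix  5 ¬ʰ_
infixr 4 _∧ʰ_
infixr 3 _∨ʰ_

data Hyper (k : ℕ) : ℕ → Set where
  ⌜_⌝       : ∀ {v} → HBody k v → Hyper k v
  ¬ʰ_       : ∀ {v} → Hyper k v → Hyper k v
  _∨ʰ_ _∧ʰ_ : ∀ {v} → Hyper k v → Hyper k v → Hyper k v
  ∃ʰ ∀ʰ     : ∀ {v} → Hyper k (suc v) → Hyper k v

prenex : ∀ {k v} → Hyper k v → HFormula k v
prenex ⌜ ψ ⌝     = body ψ
prenex (¬ʰ φ)    = negᴴ (prenex φ)
prenex (φ ∨ʰ φ′) = orᴴ (prenex φ) (prenex φ′)
prenex (φ ∧ʰ φ′) = andᴴ (prenex φ) (prenex φ′)
prenex (∃ʰ φ)    = ∃ₕ (prenex φ)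
prenex (∀ʰ φ)    = ∀ₕ (prenex φ)

module Prenex (em : ExcludedMiddle 0ℓ) where
  open Classical em
  open Stuttering em

  origin : ∀ {v} → Fin v → ℕ
  origin _ = 0

  module _ {k : ℕ} where

    Satᴾ : ∀ {v} → HFormula k v → (Fin v → Trace k) → Set
    Satᴾ (body ψ) tr = Sat tr ψ origin
    Satᴾ (∃ₕ φ)   tr = Σ (Trace k) λ σ → Satᴾ φ (ext σ tr)
    Satᴾ (∀ₕ φ)   tr = (σ : Trace k) → Satᴾ φ (ext σ tr)

    ⟦_⟧ʰ : ∀ {v} → Hyper k v → (Fin v → Trace k) → Set
    ⟦ ⌜ ψ ⌝ ⟧ʰ   tr = Sat tr ψ origin
    ⟦ ¬ʰ φ ⟧ʰ    tr = ¬ ⟦ φ ⟧ʰ tr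
    ⟦ φ ∨ʰ φ′ ⟧ʰ tr = ⟦ φ ⟧ʰ tr ⊎ ⟦ φ′ ⟧ʰ tr
    ⟦ φ ∧ʰ φ′ ⟧ʰ tr = ⟦ φ ⟧ʰ tr × ⟦ φ′ ⟧ʰ tr
    ⟦ ∃ʰ φ ⟧ʰ    tr = Σ (Trace k) λ σ → ⟦ φ ⟧ʰ (ext σ tr)
    ⟦ ∀ʰ φ ⟧ʰ    tr = (σ : Trace k) → ⟦ φ ⟧ʰ (ext σ tr)

    SatH⇔Satᴾ : ∀ {v} {L : Trace k → Set} → (∀ σ → L σ) → (φ : HFormula k v) → ∀ tr →
                SatH L φ tr ⇔ Satᴾ φ tr
    SatH⇔Satᴾ all (body ψ) tr = SatB⇔Sat ψ tr origin
    SatH⇔Satᴾ all (∃ₕ φ)   tr = mk⇔ (λ (σ , _ , sat) → σ , to (SatH⇔Satᴾ all φ (ext σ tr)) sat)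
                                     (λ (σ , sat) → σ , all σ , from (SatH⇔Satᴾ all φ (ext σ tr)) sat)
    SatH⇔Satᴾ all (∀ₕ φ)   tr = mk⇔ (λ sat σ → to (SatH⇔Satᴾ all φ (ext σ tr)) (sat σ (all σ)))
                                     (λ sat σ _ → from (SatH⇔Satᴾ all φ (ext σ tr)) (sat σ))

    Satᴾ-renameᴴ : ∀ {v w} (ρ : Fin v → Fin w) φ {tr : Fin w → Trace k} {tr′} → tr ∘ ρ ≗ tr′ →
                   Satᴾ (renameᴴ ρ φ) tr ⇔ Satᴾ φ tr′
    Satᴾ-renameᴴ ρ (body ψ) {tr} tr≗ = ⇔-trans (Sat-renameᴮ ρ ψ tr origin) (Sat-cong ψ tr≗ λ _ → refl)
    Satᴾ-renameᴴ ρ (∃ₕ φ) tr≗ = Σ-cong-⇔ λ σ → Satᴾ-renameᴴ _ φ λ { zero → refl ; (suc x) → tr≗ x }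
    Satᴾ-renameᴴ ρ (∀ₕ φ) tr≗ = Π-cong-⇔ λ σ → Satᴾ-renameᴴ _ φ λ { zero → refl ; (suc x) → tr≗ x }

    Satᴾ-weaken : ∀ {v} φ σ (tr : Fin v → Trace k) → Satᴾ (renameᴴ suc φ) (ext σ tr) ⇔ Satᴾ φ tr
    Satᴾ-weaken φ σ tr = Satᴾ-renameᴴ suc φ λ _ → refl

    Satᴾ-negᴴ : ∀ {v} φ (tr : Fin v → Trace k) → Satᴾ (negᴴ φ) tr ⇔ (¬ Satᴾ φ tr)
    Satᴾ-negᴴ (body ψ) tr = ⇔-refl
    Satᴾ-negᴴ (∃ₕ φ)   tr = ⇔-trans (Π-cong-⇔ λ σ → Satᴾ-negᴴ φ (ext σ tr)) (mk⇔ ∀¬⟶¬∃ ¬∃⟶∀¬)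
    Satᴾ-negᴴ (∀ₕ φ)   tr = ⇔-trans (Σ-cong-⇔ λ σ → Satᴾ-negᴴ φ (ext σ tr)) (⇔-sym ¬Π⇔Σ¬)

    Satᴾ-orᴴᴮ : ∀ {v} φ χ (tr : Fin v → Trace k) → Satᴾ (orᴴᴮ φ χ) tr ⇔ (Satᴾ φ tr ⊎ Sat tr χ origin)

    Satᴾ-orᴴᴮ-weaken : ∀ {v} φ χ σ (tr : Fin v → Trace k) →
                       Satᴾ (orᴴᴮ φ (renameᴮ suc χ)) (ext σ tr) ⇔ (Satᴾ φ (ext σ tr) ⊎ Sat tr χ origin)
    Satᴾ-orᴴᴮ-weaken φ χ σ tr =
      ⇔-trans (Satᴾ-orᴴᴮ φ (renameᴮ suc χ) (ext σ tr)) (⇔-refl ⊎-⇔ Sat-renameᴮ suc χ (ext σ tr) origin)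

    Satᴾ-orᴴᴮ (body ψ) χ tr = ⇔-refl
    Satᴾ-orᴴᴮ (∃ₕ φ)   χ tr = ⇔-trans (Σ-cong-⇔ λ σ → Satᴾ-orᴴᴮ-weaken φ χ σ tr) (Σ-⊎ˡ (λ _ _ → false))
    Satᴾ-orᴴᴮ (∀ₕ φ)   χ tr = ⇔-trans (Π-cong-⇔ λ σ → Satᴾ-orᴴᴮ-weaken φ χ σ tr) Π-⊎ˡ

    Satᴾ-orᴴ : ∀ {v} φ φ′ (tr : Fin v → Trace k) → Satᴾ (orᴴ φ φ′) tr ⇔ (Satᴾ φ tr ⊎ Satᴾ φ′ tr)

    Satᴾ-orᴴ-weaken : ∀ {v} φ φ′ σ (tr : Fin v → Trace k) →
                      Satᴾ (orᴴ φ (renameᴴ suc φ′)) (ext σ tr) ⇔ (Satᴾ φ (ext σ tr) ⊎ Satᴾ φ′ tr)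
    Satᴾ-orᴴ-weaken φ φ′ σ tr =
      ⇔-trans (Satᴾ-orᴴ φ (renameᴴ suc φ′) (ext σ tr)) (⇔-refl ⊎-⇔ Satᴾ-weaken φ′ σ tr)

    Satᴾ-orᴴ (body ψ) φ′ tr = ⇔-trans (Satᴾ-orᴴᴮ φ′ ψ tr) (mk⇔ swap swap)
    Satᴾ-orᴴ (∃ₕ φ)   φ′ tr = ⇔-trans (Σ-cong-⇔ λ σ → Satᴾ-orᴴ-weaken φ φ′ σ tr) (Σ-⊎ˡ (λ _ _ → false))
    Satᴾ-orᴴ (∀ₕ φ)   φ′ tr = ⇔-trans (Π-cong-⇔ λ σ → Satᴾ-orᴴ-weaken φ φ′ σ tr) Π-⊎ˡ

    Satᴾ-andᴴ : ∀ {v} φ φ′ (tr : Fin v → Trace k) → Satᴾ (andᴴ φ φ′) tr ⇔ (Satᴾ φ tr × Satᴾ φ′ tr)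
    Satᴾ-andᴴ φ φ′ tr = ⇔-trans (Satᴾ-negᴴ (orᴴ (negᴴ φ) (negᴴ φ′)) tr) (⇔-trans (¬-cong-⇔ negated-or) ¬⊎¬⇔×)
      where
      negated-or : Satᴾ (orᴴ (negᴴ φ) (negᴴ φ′)) tr ⇔ (¬ Satᴾ φ tr ⊎ ¬ Satᴾ φ′ tr)
      negated-or = ⇔-trans (Satᴾ-orᴴ (negᴴ φ) (negᴴ φ′) tr) (Satᴾ-negᴴ φ tr ⊎-⇔ Satᴾ-negᴴ φ′ tr)

    Satᴾ-prenex : ∀ {v} (φ : Hyper k v) tr → Satᴾ (prenex φ) tr ⇔ ⟦ φ ⟧ʰ tr
    Satᴾ-prenex ⌜ ψ ⌝     tr = ⇔-refl
    Satᴾ-prenex (¬ʰ φ)    tr = ⇔-trans (Satᴾ-negᴴ (prenex φ) tr) (¬-cong-⇔ (Satᴾ-prenex φ tr))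
    Satᴾ-prenex (φ ∨ʰ φ′) tr =
      ⇔-trans (Satᴾ-orᴴ (prenex φ) (prenex φ′) tr) (Satᴾ-prenex φ tr ⊎-⇔ Satᴾ-prenex φ′ tr)
    Satᴾ-prenex (φ ∧ʰ φ′) tr =
      ⇔-trans (Satᴾ-andᴴ (prenex φ) (prenex φ′) tr) (Satᴾ-prenex φ tr ×-⇔ Satᴾ-prenex φ′ tr)
    Satᴾ-prenex (∃ʰ φ)    tr = Σ-cong-⇔ λ σ → Satᴾ-prenex φ (ext σ tr)
    Satᴾ-prenex (∀ʰ φ)    tr = Π-cong-⇔ λ σ → Satᴾ-prenex φ (ext σ tr)

infixr 6 _∧ₕ_
infixr 5 _⇒ₕ_ _↔ₕ_

_∧ₕ_ _⇒ₕ_ _↔ₕ_ : ∀ {k v} → HBody k v → HBody k v → HBody k v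
ψ ∧ₕ χ = ¬ₕ ((¬ₕ ψ) ∨ₕ (¬ₕ χ))
ψ ⇒ₕ χ = (¬ₕ ψ) ∨ₕ χ
ψ ↔ₕ χ = (ψ ⇒ₕ χ) ∧ₕ (χ ⇒ₕ ψ)

-- ψ ∨ ¬ψ stands in for ⊤, which HBody lacks.
F[_] : ∀ {k v} → List (LTL k) → HBody k v → HBody k v
F[ Γ ] ψ = Uₕ Γ (ψ ∨ₕ (¬ₕ ψ)) ψ

Fₕ Gₕ : ∀ {k v} → HBody k v → HBody k v
Fₕ ψ = F[ [] ] ψ
Gₕ ψ = ¬ₕ Fₕ (¬ₕ ψ)

_+ᵖ_ : ∀ {v} → (Fin v → ℕ) → ℕ → Fin v → ℕ
(pos +ᵖ n) x = pos x + n

module Temporal (em : ExcludedMiddle 0ℓ) where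
  open Classical em
  open Stuttering em

  module _ {k v : ℕ} (tr : Fin v → Trace k) where

    Sat-∧ₕ : ∀ ψ χ pos → Sat tr (ψ ∧ₕ χ) pos ⇔ (Sat tr ψ pos × Sat tr χ pos)
    Sat-∧ₕ ψ χ pos = ¬⊎¬⇔×

    Sat-⇒ₕ : ∀ ψ χ pos → Sat tr (ψ ⇒ₕ χ) pos ⇔ (Sat tr ψ pos → Sat tr χ pos)
    Sat-⇒ₕ ψ χ pos = ¬⊎⇔→

    Sat-↔ₕ : ∀ ψ χ pos → Sat tr (ψ ↔ₕ χ) pos ⇔ (Sat tr ψ pos ⇔ Sat tr χ pos)
    Sat-↔ₕ ψ χ pos = ⇔-trans (Sat-∧ₕ (ψ ⇒ₕ χ) (χ ⇒ₕ ψ) pos)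
      (⇔-trans (Sat-⇒ₕ ψ χ pos ×-⇔ Sat-⇒ₕ χ ψ pos) (mk⇔ (λ (f , g) → mk⇔ f g) (λ e → to e , from e)))

    Sat-F[] : ∀ Γ ψ pos → Sat tr (F[ Γ ] ψ) pos ⇔ Σ ℕ λ n → Sat tr ψ (steps Γ tr n pos)
    Sat-F[] Γ ψ pos = mk⇔ (λ (n , now , _) → n , now) (λ (n , now) → n , now , λ _ _ → toSum em)

    steps-[] : ∀ n pos → steps [] tr n pos ≗ pos +ᵖ n
    steps-[] n pos x = succⁿ-≡-+ Succ-[] n (pos x)

    Sat-Uₕ : ∀ ψ χ pos → Sat tr (Uₕ [] ψ χ) pos ⇔
             Σ ℕ λ n → Sat tr χ (pos +ᵖ n) × (∀ j → j < n → Sat tr ψ (pos +ᵖ j))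
    Sat-Uₕ ψ χ pos =
      U-cong-⇔ (λ n → Sat-cong χ (λ _ → refl) (steps-[] n pos)) (λ j → Sat-cong ψ (λ _ → refl) (steps-[] j pos))

    Sat-Fₕ : ∀ ψ pos → Sat tr (Fₕ ψ) pos ⇔ Σ ℕ λ n → Sat tr ψ (pos +ᵖ n)
    Sat-Fₕ ψ pos = ⇔-trans (Sat-F[] [] ψ pos) (Σ-cong-⇔ λ n → Sat-cong ψ (λ _ → refl) (steps-[] n pos))

    Sat-Gₕ : ∀ ψ pos → Sat tr (Gₕ ψ) pos ⇔ (∀ n → Sat tr ψ (pos +ᵖ n))
    Sat-Gₕ ψ pos = ⇔-trans (¬-cong-⇔ (Sat-Fₕ (¬ₕ ψ) pos))
                           (mk⇔ (λ ¬∃ n → dne λ ¬ψ → ¬∃ (n , ¬ψ)) λ ∀ψ (n , ¬ψ) → ¬ψ (∀ψ n))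

    Sat-Xₕ : ∀ ψ pos → Sat tr (Xₕ [] ψ) pos ⇔ Sat tr ψ (suc ∘ pos)
    Sat-Xₕ ψ pos = Sat-cong ψ (λ _ → refl) λ x → succ-≡ (Succ-[] (pos x))

    Sat-G↔ : ∀ ψ χ pos → Sat tr (Gₕ (ψ ↔ₕ χ)) pos ⇔ (∀ n → Sat tr ψ (pos +ᵖ n) ⇔ Sat tr χ (pos +ᵖ n))
    Sat-G↔ ψ χ pos = ⇔-trans (Sat-Gₕ (ψ ↔ₕ χ) pos) (Π-cong-⇔ λ n → Sat-↔ₕ ψ χ (pos +ᵖ n))

mark phase prefix : Fin 3
mark   = zero
phase  = suc zero
prefix = suc (suc zero)

marked : ∀ {v} → Fin v → HBody 3 v
marked = atomₕ mark

traceOf : (marks phases prefixes : ℕ → Bool) → Trace 3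
traceOf marks phases prefixes j zero             = marks j
traceOf marks phases prefixes j (suc zero)       = phases j
traceOf marks phases prefixes j (suc (suc zero)) = prefixes j

holds-at : ∀ {k} (σ : Trace k) p {i j} → i ≡ j → (σ i p ≡ true) ⇔ (σ j p ≡ true)
holds-at σ p refl = ⇔-refl

record Numeral (σ : Trace 3) (a : ℕ) : Set where
  field
    marked-iff : ∀ j → σ j mark ≡ true ⇔ j ≡ a
    no-phase   : ∀ j → σ j phase ≡ false
    no-prefix  : ∀ j → σ j prefix ≡ false

numeral-trace : ℕ → Trace 3
numeral-trace a = traceOf (λ j → does (j ≟ a)) (λ _ → false) (λ _ → false)

numeral-trace-Numeral : ∀ a → Numeral (numeral-trace a) a
numeral-trace-Numeral a = record
  { marked-iff = λ j → does-⇔ (j ≟ a)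
  ; no-phase   = λ _ → refl
  ; no-prefix  = λ _ → refl
  }

at-most-once : {P : ℕ → Set} → (∀ n → P n → ∀ m → ¬ P (suc n + m)) → ∀ {a b} → P a → P b → a ≡ b
at-most-once {P} once {a} {b} pa pb with <-cmp a b
... | tri≈ _ a≡b _ = a≡b
... | tri< a<b _ _ = let (m , a+m≡b) = m≤n⇒∃[o]m+o≡n a<b in ⊥-elim (once a pa m (subst P (sym a+m≡b) pb))
... | tri> _ _ b<a = let (m , b+m≡a) = m≤n⇒∃[o]m+o≡n b<a in ⊥-elim (once b pb m (subst P (sym b+m≡a) pa))

numeral : ∀ {v} → Fin v → Hyper 3 v
numeral x = ⌜ Fₕ (marked x) ⌝ ∧ʰ ⌜ Gₕ (marked x ⇒ₕ Xₕ [] (Gₕ (¬ₕ marked x))) ⌝ ∧ʰ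
            ⌜ Gₕ (¬ₕ atomₕ phase x) ⌝ ∧ʰ ⌜ Gₕ (¬ₕ atomₕ prefix x) ⌝

equal : ∀ {v} → Fin v → Fin v → Hyper 3 v
equal x y = ⌜ Fₕ (marked x ∧ₕ marked y) ⌝

less : ∀ {v} → Fin v → Fin v → Hyper 3 v
less x y = ⌜ Fₕ (marked x ∧ₕ Xₕ [] (Fₕ (marked y))) ⌝

module Numerals (em : ExcludedMiddle 0ℓ) where
  open Stuttering em
  open Prenex em
  open Temporal em
  open Numeral

  module _ {v : ℕ} (tr : Fin v → Trace 3) where

    Sat-G-never : ∀ p x → Sat tr (Gₕ (¬ₕ atomₕ p x)) origin ⇔ (∀ j → tr x j p ≡ false)
    Sat-G-never p x = ⇔-trans (Sat-Gₕ tr (¬ₕ atomₕ p x) origin) (Π-cong-⇔ λ j → ¬true⇔false)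

    ⟦numeral⟧ : ∀ x → ⟦ numeral x ⟧ʰ tr ⇔ ∃ (Numeral (tr x))
    ⟦numeral⟧ x = mk⇔ decode encode
      where
      σ : Trace 3
      σ = tr x
      later : HBody 3 v
      later = Xₕ [] (Gₕ (¬ₕ marked x))
      once : Sat tr (Gₕ (marked x ⇒ₕ later)) origin ⇔ (∀ n → σ n mark ≡ true → ∀ m → ¬ σ (suc n + m) mark ≡ true)
      once = ⇔-trans (Sat-Gₕ tr (marked x ⇒ₕ later) origin) (Π-cong-⇔ λ n →
               ⇔-trans (Sat-⇒ₕ tr (marked x) later (λ _ → n)) (→-cong-⇔ ⇔-refl
                 (⇔-trans (Sat-Xₕ tr (Gₕ (¬ₕ marked x)) (λ _ → n)) (Sat-Gₕ tr (¬ₕ marked x) (λ _ → suc n)))))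
      decode : ⟦ numeral x ⟧ʰ tr → ∃ (Numeral σ)
      decode (some , unique , φ , π) with to (Sat-Fₕ tr (marked x) origin) some
      ... | a , σa = a , record
        { marked-iff = λ j → mk⇔ (λ σj → at-most-once (to once unique) σj σa) λ { refl → σa }
        ; no-phase   = to (Sat-G-never phase x) φ
        ; no-prefix  = to (Sat-G-never prefix x) π
        }
      encode : ∃ (Numeral σ) → ⟦ numeral x ⟧ʰ tr
      encode (a , N) =
        from (Sat-Fₕ tr (marked x) origin) (a , from (marked-iff N a) refl) ,
        from once (λ n σn m σm → <-irrefl (trans (to (marked-iff N n) σn) (sym (to (marked-iff N _) σm)))
                                          (s≤s (m≤m+n n m))) ,
        from (Sat-G-never phase x) (no-phase N) , from (Sat-G-never prefix x) (no-prefix N)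

    Sat-at-numeral : ∀ {x a} → Numeral (tr x) a → ∀ ψ → Sat tr (Fₕ (marked x ∧ₕ ψ)) origin ⇔ Sat tr ψ (λ _ → a)
    Sat-at-numeral {x} N ψ = ⇔-trans (Sat-Fₕ tr (marked x ∧ₕ ψ) origin)
      (⇔-trans (Σ-cong-⇔ λ n → ⇔-trans (Sat-∧ₕ tr (marked x) ψ (λ _ → n)) (marked-iff N n ×-⇔ ⇔-refl)) one-point)

    Sat-F-marked : ∀ {x a pos} → Numeral (tr x) a → Sat tr (Fₕ (marked x)) pos ⇔ pos x ≤ a
    Sat-F-marked {x} {a} {pos} N = ⇔-trans (Sat-Fₕ tr (marked x) pos) (mk⇔
      (λ (m , σm) → subst (pos x ≤_) (to (marked-iff N _) σm) (m≤m+n (pos x) m))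
      (λ x≤a → a ∸ pos x , from (marked-iff N _) (m+[n∸m]≡n x≤a)))

    Sat-G-prefix : ∀ {x a} → Numeral (tr x) a → ∀ s →
                   Sat tr (Gₕ (atomₕ prefix s ↔ₕ Fₕ (marked x))) origin ⇔ (∀ n → tr s n prefix ≡ true ⇔ n ≤ a)
    Sat-G-prefix {x} N s = ⇔-trans (Sat-G↔ tr (atomₕ prefix s) (Fₕ (marked x)) origin)
                                   (Π-cong-⇔ λ n → ⇔-cong-⇔ ⇔-refl (Sat-F-marked N))

    Sat-G-copy : ∀ {z c} → Numeral (tr z) c → ∀ s p →
                 Sat tr (Gₕ (atomₕ p s ↔ₕ marked z)) origin ⇔ (∀ n → tr s n p ≡ true ⇔ n ≡ c)
    Sat-G-copy {z} N s p = ⇔-trans (Sat-G↔ tr (atomₕ p s) (marked z) origin)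
                                   (Π-cong-⇔ λ n → ⇔-cong-⇔ ⇔-refl (marked-iff N n))

    ⟦equal⟧ : ∀ {x a} → Numeral (tr x) a → ∀ y → ⟦ equal x y ⟧ʰ tr ⇔ tr y a mark ≡ true
    ⟦equal⟧ N y = Sat-at-numeral N (marked y)

    ⟦less⟧ : ∀ {x y a b} → Numeral (tr x) a → Numeral (tr y) b → ⟦ less x y ⟧ʰ tr ⇔ a < b
    ⟦less⟧ {y = y} {a} N M = ⇔-trans (Sat-at-numeral N (Xₕ [] (Fₕ (marked y))))
                                     (⇔-trans (Sat-Xₕ tr (Fₕ (marked y)) (λ _ → a)) (Sat-F-marked M))

record Adder (σ : Trace 3) (a b c : ℕ) : Set where
  field
    prefix-iff : ∀ n → σ n prefix ≡ true ⇔ n ≤ a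
    marked-iff : ∀ n → σ n mark ≡ true ⇔ n ≡ c
    shifted    : ∀ n → suc n ≡ b ⇔ σ (suc a + n) mark ≡ true
    base       : 0 ≡ b → a ≡ c

adder-trace : ℕ → ℕ → Trace 3
adder-trace a c = traceOf (λ j → does (j ≟ c)) (λ _ → false) (λ j → does (j ≤? a))

∃Adder⇔+ : ∀ {a b c} → (∃ λ σ → Adder σ a b c) ⇔ (a + b ≡ c)
∃Adder⇔+ {a} {b} {c} = mk⇔ sound (λ a+b≡c → adder-trace a c , complete a+b≡c)
  where
  open Adder
  sound : ∀ {b} → ∃ (λ σ → Adder σ a b c) → a + b ≡ c
  sound {zero}  (σ , A) = trans (+-identityʳ a) (base A refl)
  sound {suc b} (σ , A) = trans (+-suc a b) (to (marked-iff A _) (to (shifted A b) refl))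
  suc≡⇔+suc≡ : ∀ n → suc n ≡ b ⇔ suc a + n ≡ a + b
  suc≡⇔+suc≡ n = mk⇔ (λ { refl → sym (+-suc a n) }) (λ eq → +-cancelˡ-≡ a _ _ (trans (+-suc a n) eq))
  complete : a + b ≡ c → Adder (adder-trace a c) a b c
  complete refl = record
    { prefix-iff = λ n → does-⇔ (n ≤? a)
    ; marked-iff = λ n → does-⇔ (n ≟ a + b)
    ; shifted    = λ n → ⇔-trans (suc≡⇔+suc≡ n) (⇔-sym (does-⇔ (suc a + n ≟ a + b)))
    ; base       = λ { refl → sym (+-identityʳ a) }
    }

-- X_prefix moves s from 0 to a + 1 but y only to 1; the last conjunct covers b = 0.
adder : ∀ {v} → (s x y z : Fin v) → Hyper 3 v
adder s x y z = ⌜ Gₕ (atomₕ prefix s ↔ₕ Fₕ (marked x)) ⌝ ∧ʰ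
                ⌜ Gₕ (marked s ↔ₕ marked z) ⌝ ∧ʰ
                ⌜ Xₕ (atom prefix ∷ []) (Gₕ (marked y ↔ₕ marked s)) ⌝ ∧ʰ
                ⌜ marked y ⇒ₕ Fₕ (marked x ∧ₕ marked z) ⌝

sum : ∀ {v} → Fin v → Fin v → Fin v → Hyper 3 v
sum x y z = ∃ʰ (adder zero (suc x) (suc y) (suc z))

module Addition (em : ExcludedMiddle 0ℓ) where
  open Stuttering em
  open Prenex em
  open Temporal em
  open Numerals em
  open Numeral

  module _ {v : ℕ} (tr : Fin v → Trace 3) {s x y z : Fin v} {a b c : ℕ}
           (N : Numeral (tr x) a) (M : Numeral (tr y) b) (L : Numeral (tr z) c) where

    Sat-shifted : (∀ n → tr s n prefix ≡ true ⇔ n ≤ a) →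
                  Sat tr (Xₕ (atom prefix ∷ []) (Gₕ (marked y ↔ₕ marked s))) origin ⇔
                  (∀ n → suc n ≡ b ⇔ tr s (suc a + n) mark ≡ true)
    Sat-shifted prefix-iff =
      ⇔-trans (Sat-G↔ tr (marked y) (marked s) (step (atom prefix ∷ []) tr origin)) (Π-cong-⇔ λ n → ⇔-cong-⇔
        (⇔-trans (holds-at (tr y) mark (cong (_+ n) (succ-atom-constant (no-prefix M) 0))) (marked-iff M (suc n)))
        (holds-at (tr s) mark (cong (_+ n) (succ-atom-prefix prefix-iff))))

    Sat-base : Sat tr (marked y ⇒ₕ Fₕ (marked x ∧ₕ marked z)) origin ⇔ (0 ≡ b → a ≡ c)
    Sat-base = ⇔-trans (Sat-⇒ₕ tr (marked y) (Fₕ (marked x ∧ₕ marked z)) origin)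
                       (→-cong-⇔ (marked-iff M 0) (⇔-trans (Sat-at-numeral tr N (marked z)) (marked-iff L a)))

    ⟦adder⟧ : ⟦ adder s x y z ⟧ʰ tr ⇔ Adder (tr s) a b c
    ⟦adder⟧ = mk⇔
      (λ (g₁ , g₂ , g₃ , g₄) → let prefix-iff = to (Sat-G-prefix tr N s) g₁ in record
        { prefix-iff = prefix-iff
        ; marked-iff = to (Sat-G-copy tr L s mark) g₂
        ; shifted    = to (Sat-shifted prefix-iff) g₃
        ; base       = to Sat-base g₄
        })
      (λ A → from (Sat-G-prefix tr N s) (Adder.prefix-iff A) , from (Sat-G-copy tr L s mark) (Adder.marked-iff A) ,
             from (Sat-shifted (Adder.prefix-iff A)) (Adder.shifted A) , from Sat-base (Adder.base A))

  ⟦sum⟧ : ∀ {v} (tr : Fin v → Trace 3) {x y z a b c} →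
          Numeral (tr x) a → Numeral (tr y) b → Numeral (tr z) c → ⟦ sum x y z ⟧ʰ tr ⇔ (a + b ≡ c)
  ⟦sum⟧ tr N M L = ⇔-trans (Σ-cong-⇔ λ σ → ⟦adder⟧ (ext σ tr) {s = zero} N M L) ∃Adder⇔+

record Alternating (σ : Trace 3) (a : ℕ) : Set where
  field
    first-block : ∀ t → t < a → σ t phase ≡ true
    flip        : ∀ i → σ (i + a) phase ≡ not (σ i phase)

parity : ℕ → Bool
parity zero    = true
parity (suc n) = not (parity n)

phase-trace : ℕ → ℕ → Bool
phase-trace a i = parity (i / suc a)

phase-trace-Alternating : ∀ a {marks prefixes} → Alternating (traceOf marks (phase-trace a) prefixes) (suc a)
phase-trace-Alternating a = record
  { first-block = λ t t<a → cong parity (m<n⇒m/n≡0 t<a)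
  ; flip        = λ i → cong parity (trans (m/n≡1+[m∸n]/n (m≤n+m (suc a) i))
                                           (cong (λ m → suc (m / suc a)) (m+n∸n≡m i (suc a))))
  }

record Multiplier (w s : Trace 3) (a b c : ℕ) : Set where
  field
    positive    : ¬ 0 ≡ a
    same-phase  : ∀ n → w n phase ≡ true ⇔ s n phase ≡ true
    prefix-iff  : ∀ n → s n prefix ≡ true ⇔ n ≤ a
    no-prefix   : ∀ n → w n prefix ≡ false
    first-block : (∀ t → t < a → w t phase ≡ true) × ¬ w a phase ≡ true
    flips       : ∀ n → w (suc n) phase ≡ true ⇔ (¬ s (suc a + n) phase ≡ true)
    marked-iff  : ∀ n → w n mark ≡ true ⇔ n ≡ c
    hit         : w (b * a) mark ≡ true

phase-alternates : ∀ {w s : Trace 3} {a} → ¬ 0 ≡ a → (∀ t → t < a → w t phase ≡ true) × ¬ w a phase ≡ true →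
                   (∀ n → w n phase ≡ true ⇔ s n phase ≡ true) →
                   (∀ n → w (suc n) phase ≡ true ⇔ (¬ s (suc a + n) phase ≡ true)) → Alternating w a
phase-alternates {w} {s} {a} positive (first-block , ¬wa) same-phase flips =
  record { first-block = first-block ; flip = flip }
  where
  flip : ∀ i → w (i + a) phase ≡ not (w i phase)
  flip zero    = trans (¬-not ¬wa) (cong not (sym (first-block 0 (n≢0⇒n>0 (positive ∘ sym)))))
  flip (suc n) = trans (cong (λ i → w i phase) (cong suc (+-comm n a)))
                       (from ≡not⇔ (⇔-trans (flips n) (¬-cong-⇔ (⇔-sym (same-phase (suc a + n))))))

multiplier-traces : ℕ → ℕ → Trace 3 × Trace 3
multiplier-traces a c = traceOf (λ j → does (j ≟ c)) (phase-trace a) (λ _ → false) ,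
                        traceOf (λ _ → false) (phase-trace a) (λ j → does (j ≤? suc a))

∃Multiplier⇔* : ∀ {a b c} → (∃ λ w → ∃ λ s → Multiplier w s a b c) ⇔ (¬ 0 ≡ a × a * b ≡ c)
∃Multiplier⇔* {a} {b} {c} = mk⇔ sound complete
  where
  sound : (∃ λ w → ∃ λ s → Multiplier w s a b c) → ¬ 0 ≡ a × a * b ≡ c
  sound (w , s , M) = positive , trans (*-comm a b) (to (marked-iff (b * a)) hit)
    where open Multiplier M
  complete : ∀ {a c} → ¬ 0 ≡ a × a * b ≡ c → ∃ λ w → ∃ λ s → Multiplier w s a b c
  complete {zero}   (positive , _)    = ⊥-elim (positive refl)
  complete {suc a′} (positive , refl) = w , s , record
    { positive    = positive
    ; same-phase  = λ _ → ⇔-refl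
    ; prefix-iff  = λ n → does-⇔ (n ≤? suc a′)
    ; no-prefix   = λ _ → refl
    ; first-block = first-block ,
                    λ wa → not-¬ refl (trans (sym wa) (trans (flip 0) (cong not (first-block 0 (s≤s z≤n)))))
    ; flips       = λ n → to ≡not⇔ (trans (cong (λ i → w i phase) (cong suc (+-comm (suc a′) n))) (flip (suc n)))
    ; marked-iff  = λ n → does-⇔ (n ≟ suc a′ * b)
    ; hit         = from (does-⇔ (b * suc a′ ≟ suc a′ * b)) (*-comm b (suc a′))
    }
    where
    w = proj₁ (multiplier-traces a′ (suc a′ * b))
    s = proj₂ (multiplier-traces a′ (suc a′ * b))
    open Alternating (phase-trace-Alternating a′ {λ j → does (j ≟ suc a′ * b)} {λ _ → false})

zero-or-positive : ∀ {a b c} → ((0 ≡ a × 0 ≡ c) ⊎ (¬ 0 ≡ a × a * b ≡ c)) ⇔ (a * b ≡ c)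
zero-or-positive {a} {b} {c} = mk⇔ (λ { (inj₁ (refl , refl)) → refl ; (inj₂ (_ , ab≡c)) → ab≡c }) by-cases
  where
  by-cases : ∀ {a} → a * b ≡ c → (0 ≡ a × 0 ≡ c) ⊎ (¬ 0 ≡ a × a * b ≡ c)
  by-cases {zero}  0≡c  = inj₁ (refl , 0≡c)
  by-cases {suc a} ab≡c = inj₂ ((λ ()) , ab≡c)

-- The phase of w is checked against its copy s, which X_prefix shifts a steps ahead of w.
multiplier : ∀ {v} → (w s x y z : Fin v) → Hyper 3 v
multiplier w s x y z =
  ⌜ ¬ₕ marked x ⌝ ∧ʰ
  ⌜ Gₕ (atomₕ phase w ↔ₕ atomₕ phase s) ⌝ ∧ʰ
  ⌜ Gₕ (atomₕ prefix s ↔ₕ Fₕ (marked x)) ⌝ ∧ʰ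
  ⌜ Gₕ (¬ₕ atomₕ prefix w) ⌝ ∧ʰ
  ⌜ Uₕ [] (atomₕ phase w) (marked x ∧ₕ (¬ₕ atomₕ phase w)) ⌝ ∧ʰ
  ⌜ Xₕ (atom prefix ∷ []) (Gₕ (atomₕ phase w ↔ₕ (¬ₕ atomₕ phase s))) ⌝ ∧ʰ
  ⌜ Gₕ (marked w ↔ₕ marked z) ⌝ ∧ʰ
  ⌜ F[ atom phase ∷ [] ] (marked y ∧ₕ marked w) ⌝

product : ∀ {v} → Fin v → Fin v → Fin v → Hyper 3 v
product x y z = ⌜ marked x ∧ₕ marked z ⌝ ∨ʰ
                ∃ʰ (∃ʰ (multiplier (suc zero) zero (suc (suc x)) (suc (suc y)) (suc (suc z))))

module Multiplication (em : ExcludedMiddle 0ℓ) where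
  open Stuttering em
  open Prenex em
  open Temporal em
  open Numerals em
  open Numeral

  module _ {σ : Trace 3} {a : ℕ} (A : Alternating σ a) where
    open Alternating A

    phase-block : ∀ j t → t < a → σ (t + j * a) phase ≡ σ (j * a) phase
    phase-block zero    t t<a = trans (cong (λ i → σ i phase) (+-identityʳ t))
                                      (trans (first-block t t<a) (sym (first-block 0 (≤-<-trans z≤n t<a))))
    phase-block (suc j) t t<a = begin
      σ (t + (a + j * a)) phase ≡⟨ cong (λ i → σ i phase) (trans (cong (t +_) (+-comm a (j * a)))
                                                                 (sym (+-assoc t (j * a) a))) ⟩
      σ (t + j * a + a) phase   ≡⟨ flip (t + j * a) ⟩
      not (σ (t + j * a) phase) ≡⟨ cong not (phase-block j t t<a) ⟩
      not (σ (j * a) phase)     ≡⟨ flip (j * a) ⟨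
      σ (j * a + a) phase       ≡⟨ cong (λ i → σ i phase) (+-comm (j * a) a) ⟩
      σ (a + j * a) phase       ∎
      where open ≡-Reasoning

    succ-phase : 0 < a → ∀ j → succ (atom phase ∷ []) σ (j * a) ≡ suc j * a
    succ-phase 0<a j = succ-≡ (Succ-atom-block (m<n+m (j * a) 0<a) block end)
      where
      block : ∀ m → j * a ≤ m → m < a + j * a → σ m phase ≡ σ (j * a) phase
      block m ja≤m m<a+ja with m≤n⇒∃[o]m+o≡n ja≤m
      ... | t , refl = trans (cong (λ i → σ i phase) (+-comm (j * a) t)) (phase-block j t t<a)
        where t<a = +-cancelˡ-< (j * a) t a (subst (j * a + t <_) (+-comm a (j * a)) m<a+ja)
      end : σ (a + j * a) phase ≢ σ (j * a) phase
      end eq = not-¬ refl (trans (sym eq) (trans (cong (λ i → σ i phase) (+-comm a (j * a))) (flip (j * a))))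

    succⁿ-phase : 0 < a → ∀ n j → iterate (succ (atom phase ∷ []) σ) (j * a) n ≡ (j + n) * a
    succⁿ-phase 0<a zero    j = cong (_* a) (sym (+-identityʳ j))
    succⁿ-phase 0<a (suc n) j = begin
      iterate (succ _ σ) (succ _ σ (j * a)) n ≡⟨ cong (λ i → iterate (succ _ σ) i n) (succ-phase 0<a j) ⟩
      iterate (succ _ σ) (suc j * a) n        ≡⟨ succⁿ-phase 0<a n (suc j) ⟩
      (suc j + n) * a                         ≡⟨ cong (_* a) (+-suc j n) ⟨
      (j + suc n) * a                         ∎
      where open ≡-Reasoning

  module _ {v : ℕ} (tr : Fin v → Trace 3) {w s x y z : Fin v} {a b c : ℕ}
           (N : Numeral (tr x) a) (M : Numeral (tr y) b) (L : Numeral (tr z) c) where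

    Sat-first-block : Sat tr (Uₕ [] (atomₕ phase w) (marked x ∧ₕ (¬ₕ atomₕ phase w))) origin ⇔
                      ((∀ t → t < a → tr w t phase ≡ true) × ¬ tr w a phase ≡ true)
    Sat-first-block = ⇔-trans (Sat-Uₕ tr (atomₕ phase w) (marked x ∧ₕ (¬ₕ atomₕ phase w)) origin) (mk⇔ first
      λ (before , ¬wa) → a , from (at-end a) (from (marked-iff N a) refl , ¬wa) , before)
      where
      at-end : ∀ n → Sat tr (marked x ∧ₕ (¬ₕ atomₕ phase w)) (λ _ → n) ⇔ (tr x n mark ≡ true × ¬ tr w n phase ≡ true)
      at-end n = Sat-∧ₕ tr (marked x) (¬ₕ atomₕ phase w) (λ _ → n)
      first : (Σ ℕ λ n → Sat tr (marked x ∧ₕ (¬ₕ atomₕ phase w)) (λ _ → n) × (∀ j → j < n → tr w j phase ≡ true)) →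
              (∀ t → t < a → tr w t phase ≡ true) × ¬ tr w a phase ≡ true
      first (n , now , before) with to (at-end n) now
      ... | xn , ¬wn with to (marked-iff N n) xn
      ... | refl = before , ¬wn

    Sat-flips : (∀ n → tr s n prefix ≡ true ⇔ n ≤ a) → (∀ n → tr w n prefix ≡ false) →
                Sat tr (Xₕ (atom prefix ∷ []) (Gₕ (atomₕ phase w ↔ₕ (¬ₕ atomₕ phase s)))) origin ⇔
                (∀ n → tr w (suc n) phase ≡ true ⇔ (¬ tr s (suc a + n) phase ≡ true))
    Sat-flips prefix-iff no-prefix =
      ⇔-trans (Sat-G↔ tr (atomₕ phase w) (¬ₕ atomₕ phase s) (step (atom prefix ∷ []) tr origin)) (Π-cong-⇔ λ n →
        ⇔-cong-⇔ (holds-at (tr w) phase (cong (_+ n) (succ-atom-constant no-prefix 0)))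
                 (¬-cong-⇔ (holds-at (tr s) phase (cong (_+ n) (succ-atom-prefix prefix-iff)))))

    Sat-hit : Alternating (tr w) a → 0 < a →
              Sat tr (F[ atom phase ∷ [] ] (marked y ∧ₕ marked w)) origin ⇔ tr w (b * a) mark ≡ true
    Sat-hit A 0<a = ⇔-trans (Sat-F[] tr (atom phase ∷ []) (marked y ∧ₕ marked w) origin) (⇔-trans (Σ-cong-⇔ λ n →
      ⇔-trans (Sat-∧ₕ tr (marked y) (marked w) (steps (atom phase ∷ []) tr n origin))
        (⇔-trans (holds-at (tr y) mark (succⁿ-≡-+ (Succ-atom-constant (no-phase M)) n 0)) (marked-iff M n) ×-⇔
         holds-at (tr w) mark (succⁿ-phase A 0<a n 0))) one-point)

    ⟦multiplier⟧ : ⟦ multiplier w s x y z ⟧ʰ tr ⇔ Multiplier (tr w) (tr s) a b c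
    ⟦multiplier⟧ = mk⇔ read write
      where
      open Multiplier
      positivity : ¬ 0 ≡ a → 0 < a
      positivity ¬0≡a = n≢0⇒n>0 (¬0≡a ∘ sym)
      read : ⟦ multiplier w s x y z ⟧ʰ tr → Multiplier (tr w) (tr s) a b c
      read (g₁ , g₂ , g₃ , g₄ , g₅ , g₆ , g₇ , g₈) = record
        { positive    = positive′
        ; same-phase  = same-phase′
        ; prefix-iff  = prefix-iff′
        ; no-prefix   = no-prefix′
        ; first-block = first-block′
        ; flips       = flips′
        ; marked-iff  = to (Sat-G-copy tr L w mark) g₇
        ; hit         = to (Sat-hit alternating (positivity positive′)) g₈
        }
        where
        positive′    = to (¬-cong-⇔ (marked-iff N 0)) g₁
        same-phase′  = to (Sat-G↔ tr (atomₕ phase w) (atomₕ phase s) origin) g₂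
        prefix-iff′  = to (Sat-G-prefix tr N s) g₃
        no-prefix′   = to (Sat-G-never tr prefix w) g₄
        first-block′ = to Sat-first-block g₅
        flips′       = to (Sat-flips prefix-iff′ no-prefix′) g₆
        alternating  = phase-alternates {s = tr s} positive′ first-block′ same-phase′ flips′
      write : Multiplier (tr w) (tr s) a b c → ⟦ multiplier w s x y z ⟧ʰ tr
      write K = from (¬-cong-⇔ (marked-iff N 0)) (positive K) ,
                from (Sat-G↔ tr (atomₕ phase w) (atomₕ phase s) origin) (same-phase K) ,
                from (Sat-G-prefix tr N s) (prefix-iff K) ,
                from (Sat-G-never tr prefix w) (no-prefix K) ,
                from Sat-first-block (first-block K) ,
                from (Sat-flips (prefix-iff K) (no-prefix K)) (flips K) ,
                from (Sat-G-copy tr L w mark) (marked-iff K) ,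
                from (Sat-hit alternating (positivity (positive K))) (hit K)
        where alternating = phase-alternates {s = tr s} (positive K) (first-block K) (same-phase K) (flips K)

  ⟦product⟧ : ∀ {v} (tr : Fin v → Trace 3) {x y z a b c} →
              Numeral (tr x) a → Numeral (tr y) b → Numeral (tr z) c → ⟦ product x y z ⟧ʰ tr ⇔ (a * b ≡ c)
  ⟦product⟧ tr {x} {y} {z} {a} {b} {c} N M L = ⇔-trans (zero-case ⊎-⇔ positive-case) zero-or-positive
    where
    zero-case : Sat tr (marked x ∧ₕ marked z) origin ⇔ (0 ≡ a × 0 ≡ c)
    zero-case = ⇔-trans (Sat-∧ₕ tr (marked x) (marked z) origin) (marked-iff N 0 ×-⇔ marked-iff L 0)
    positive-case : (Σ (Trace 3) λ σ₁ → Σ (Trace 3) λ σ₂ →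
                       ⟦ multiplier (suc zero) zero (suc (suc x)) (suc (suc y)) (suc (suc z)) ⟧ʰ (ext σ₂ (ext σ₁ tr))) ⇔
                    (¬ 0 ≡ a × a * b ≡ c)
    positive-case = ⇔-trans (Σ-cong-⇔ λ σ₁ → Σ-cong-⇔ λ σ₂ →
                               ⟦multiplier⟧ (ext σ₂ (ext σ₁ tr)) {w = suc zero} {s = zero} N M L)
                            ∃Multiplier⇔*

∃ℕ ∀ℕ : ∀ {v} → Hyper 3 (suc v) → Hyper 3 v
∃ℕ φ = ∃ʰ (numeral zero ∧ʰ φ)
∀ℕ φ = ∀ʰ ((¬ʰ numeral zero) ∨ʰ φ)

mutual
  value : ∀ {n v} → Term n → (Fin n → Fin v) → Fin v → Hyper 3 v
  value (var i) nv z = equal (nv i) z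
  value (s ⊕ t) nv z = relate (sum (suc zero) zero (suc (suc z))) s t nv
  value (s ⊗ t) nv z = relate (product (suc zero) zero (suc (suc z))) s t nv

  relate : ∀ {n v} → Hyper 3 (suc (suc v)) → Term n → Term n → (Fin n → Fin v) → Hyper 3 v
  relate R s t nv = ∃ℕ (∃ℕ (value s (λ i → suc (suc (nv i))) (suc zero) ∧ʰ value t (λ i → suc (suc (nv i))) zero ∧ʰ R))

translate : ∀ {n m v} → SOFormula n m → (Fin n → Fin v) → (Fin m → Fin v) → Hyper 3 v
translate (s ≐ t)  nv sv = relate (equal (suc zero) zero) s t nv
translate (s ≺ t)  nv sv = relate (less (suc zero) zero) s t nv
translate (t ∈ₛ X) nv sv = ∃ℕ (value t (suc ∘ nv) zero ∧ʰ equal zero (suc (sv X)))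
translate (¬ₛ φ)   nv sv = ¬ʰ translate φ nv sv
translate (φ ∨ₛ ψ) nv sv = translate φ nv sv ∨ʰ translate ψ nv sv
translate (φ ∧ₛ ψ) nv sv = translate φ nv sv ∧ʰ translate ψ nv sv
translate (∃₁ φ)   nv sv = ∃ℕ (translate φ (ext zero (suc ∘ nv)) (suc ∘ sv))
translate (∀₁ φ)   nv sv = ∀ℕ (translate φ (ext zero (suc ∘ nv)) (suc ∘ sv))
translate (∃₂ φ)   nv sv = ∃ʰ (translate φ (suc ∘ nv) (ext zero (suc ∘ sv)))
translate (∀₂ φ)   nv sv = ∀ʰ (translate φ (suc ∘ nv) (ext zero (suc ∘ sv)))

set-trace : NSet → Trace 3
set-trace S = traceOf S (λ _ → false) (λ _ → false)

NumeralsFor : ∀ {n v} → (Fin v → Trace 3) → (Fin n → Fin v) → (Fin n → ℕ) → Set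
NumeralsFor tr nv ρ = ∀ i → Numeral (tr (nv i)) (ρ i)

SetsFor : ∀ {m v} → (Fin v → Trace 3) → (Fin m → Fin v) → (Fin m → NSet) → Set
SetsFor tr sv η = ∀ X j → tr (sv X) j mark ≡ η X j

NumeralsFor-ext : ∀ {n v σ a} {tr : Fin v → Trace 3} {nv : Fin n → Fin v} {ρ} →
                  Numeral σ a → NumeralsFor tr nv ρ → NumeralsFor (ext σ tr) (ext zero (suc ∘ nv)) (ext a ρ)
NumeralsFor-ext N numerals zero    = N
NumeralsFor-ext N numerals (suc i) = numerals i

SetsFor-ext : ∀ {m v σ S} {tr : Fin v → Trace 3} {sv : Fin m → Fin v} {η} →
              (∀ j → σ j mark ≡ S j) → SetsFor tr sv η → SetsFor (ext σ tr) (ext zero (suc ∘ sv)) (ext S η)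
SetsFor-ext σ≗S sets zero    = σ≗S
SetsFor-ext σ≗S sets (suc X) = sets X

module Translation (em : ExcludedMiddle 0ℓ) where
  open Classical em
  open Prenex em
  open Numerals em
  open Addition em using (⟦sum⟧)
  open Multiplication em using (⟦product⟧)
  open Numeral

  module _ {v : ℕ} (tr : Fin v → Trace 3) where

    ⟦∃ℕ⟧ : ∀ φ {P : ℕ → Set} → (∀ σ a → Numeral σ a → ⟦ φ ⟧ʰ (ext σ tr) ⇔ P a) → ⟦ ∃ℕ φ ⟧ʰ tr ⇔ Σ ℕ P
    ⟦∃ℕ⟧ φ meaning = mk⇔
      (λ (σ , num , sat) → let (a , N) = to (⟦numeral⟧ (ext σ tr) zero) num in a , to (meaning σ a N) sat)
      (λ (a , p) → numeral-trace a , from (⟦numeral⟧ (ext (numeral-trace a) tr) zero) (a , numeral-trace-Numeral a) ,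
                   from (meaning _ a (numeral-trace-Numeral a)) p)

    ⟦∀ℕ⟧ : ∀ φ {P : ℕ → Set} → (∀ σ a → Numeral σ a → ⟦ φ ⟧ʰ (ext σ tr) ⇔ P a) → ⟦ ∀ℕ φ ⟧ʰ tr ⇔ (∀ a → P a)
    ⟦∀ℕ⟧ φ meaning = ⇔-trans (Π-cong-⇔ λ σ → ¬⊎⇔→) (mk⇔
      (λ sat a → to (meaning _ a (numeral-trace-Numeral a)) (sat (numeral-trace a)
                    (from (⟦numeral⟧ (ext (numeral-trace a) tr) zero) (a , numeral-trace-Numeral a))))
      (λ p σ num → let (a , N) = to (⟦numeral⟧ (ext σ tr) zero) num in from (meaning σ a N) (p a)))

    ⟦∃ʰ⟧-set : ∀ φ {P : NSet → Set} → (∀ σ S → (∀ j → σ j mark ≡ S j) → ⟦ φ ⟧ʰ (ext σ tr) ⇔ P S) →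
               ⟦ ∃ʰ φ ⟧ʰ tr ⇔ Σ NSet P
    ⟦∃ʰ⟧-set φ meaning = mk⇔ (λ (σ , sat) → (λ j → σ j mark) , to (meaning σ _ λ _ → refl) sat)
                             (λ (S , p) → set-trace S , from (meaning (set-trace S) S λ _ → refl) p)

    ⟦∀ʰ⟧-set : ∀ φ {P : NSet → Set} → (∀ σ S → (∀ j → σ j mark ≡ S j) → ⟦ φ ⟧ʰ (ext σ tr) ⇔ P S) →
               ⟦ ∀ʰ φ ⟧ʰ tr ⇔ (∀ S → P S)
    ⟦∀ʰ⟧-set φ meaning = mk⇔ (λ sat S → to (meaning (set-trace S) S λ _ → refl) (sat (set-trace S)))
                             (λ p σ → from (meaning σ _ λ _ → refl) (p (λ j → σ j mark)))

  mutual
    ⟦value⟧ : ∀ {n v} t (tr : Fin v → Trace 3) nv {ρ : Fin n → ℕ} z {c} →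
              NumeralsFor tr nv ρ → Numeral (tr z) c → ⟦ value t nv z ⟧ʰ tr ⇔ (evalT ρ t ≡ c)
    ⟦value⟧ (var i) tr nv z numerals L = ⇔-trans (⟦equal⟧ tr (numerals i) z) (marked-iff L _)
    ⟦value⟧ (s ⊕ t) tr nv z numerals L =
      ⟦relate⟧ (sum (suc zero) zero (suc (suc z))) s t tr nv numerals λ σ₁ σ₂ N M →
        ⟦sum⟧ (ext σ₂ (ext σ₁ tr)) {suc zero} {zero} {suc (suc z)} N M L
    ⟦value⟧ (s ⊗ t) tr nv z numerals L =
      ⟦relate⟧ (product (suc zero) zero (suc (suc z))) s t tr nv numerals λ σ₁ σ₂ N M →
        ⟦product⟧ (ext σ₂ (ext σ₁ tr)) {suc zero} {zero} {suc (suc z)} N M L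

    ⟦relate⟧ : ∀ {n v} R s t (tr : Fin v → Trace 3) nv {ρ : Fin n → ℕ} {S : ℕ → ℕ → Set} →
               NumeralsFor tr nv ρ →
               (∀ σ₁ σ₂ {a b} → Numeral σ₁ a → Numeral σ₂ b → ⟦ R ⟧ʰ (ext σ₂ (ext σ₁ tr)) ⇔ S a b) →
               ⟦ relate R s t nv ⟧ʰ tr ⇔ S (evalT ρ s) (evalT ρ t)
    ⟦relate⟧ {n} {v} R s t tr nv numerals meaning = ⇔-trans
      (⟦∃ℕ⟧ tr (∃ℕ values) λ σ₁ a N → ⟦∃ℕ⟧ (ext σ₁ tr) values λ σ₂ b M →
         ⟦value⟧ s (ext σ₂ (ext σ₁ tr)) nv₂ (suc zero) numerals N ×-⇔
         ⟦value⟧ t (ext σ₂ (ext σ₁ tr)) nv₂ zero numerals M ×-⇔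
         meaning σ₁ σ₂ N M)
      one-point₂
      where
      nv₂ : Fin n → Fin (suc (suc v))
      nv₂ i = suc (suc (nv i))
      values : Hyper 3 (suc (suc v))
      values = value s nv₂ (suc zero) ∧ʰ value t nv₂ zero ∧ʰ R

  ⟦translate⟧ : ∀ {n m v} φ (tr : Fin v → Trace 3) nv sv {ρ : Fin n → ℕ} {η : Fin m → NSet} →
                NumeralsFor tr nv ρ → SetsFor tr sv η → ⟦ translate φ nv sv ⟧ʰ tr ⇔ ⟦ φ ⟧SO ρ η
  ⟦translate⟧ (s ≐ t)  tr nv sv numerals sets =
    ⟦relate⟧ (equal (suc zero) zero) s t tr nv numerals λ σ₁ σ₂ {a} N M →
      ⇔-trans (⟦equal⟧ (ext σ₂ (ext σ₁ tr)) {suc zero} N zero) (marked-iff M a)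
  ⟦translate⟧ (s ≺ t)  tr nv sv numerals sets =
    ⟦relate⟧ (less (suc zero) zero) s t tr nv numerals λ σ₁ σ₂ N M →
      ⟦less⟧ (ext σ₂ (ext σ₁ tr)) {suc zero} {zero} N M
  ⟦translate⟧ (t ∈ₛ X) tr nv sv numerals sets = ⇔-trans
    (⟦∃ℕ⟧ tr (value t (suc ∘ nv) zero ∧ʰ equal zero (suc (sv X))) λ σ a N →
       ⟦value⟧ t (ext σ tr) (suc ∘ nv) zero numerals N ×-⇔
       ⇔-trans (⟦equal⟧ (ext σ tr) {zero} N (suc (sv X))) (mk⇔ (trans (sym (sets X a))) (trans (sets X a))))
    one-point′
  ⟦translate⟧ (¬ₛ φ)   tr nv sv numerals sets = ¬-cong-⇔ (⟦translate⟧ φ tr nv sv numerals sets)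
  ⟦translate⟧ (φ ∨ₛ ψ) tr nv sv numerals sets =
    ⟦translate⟧ φ tr nv sv numerals sets ⊎-⇔ ⟦translate⟧ ψ tr nv sv numerals sets
  ⟦translate⟧ (φ ∧ₛ ψ) tr nv sv numerals sets =
    ⟦translate⟧ φ tr nv sv numerals sets ×-⇔ ⟦translate⟧ ψ tr nv sv numerals sets
  ⟦translate⟧ (∃₁ φ)   tr nv sv numerals sets =
    ⟦∃ℕ⟧ tr (translate φ (ext zero (suc ∘ nv)) (suc ∘ sv)) λ σ a N →
      ⟦translate⟧ φ (ext σ tr) (ext zero (suc ∘ nv)) (suc ∘ sv) (NumeralsFor-ext {nv = nv} N numerals) sets
  ⟦translate⟧ (∀₁ φ)   tr nv sv numerals sets =
    ⟦∀ℕ⟧ tr (translate φ (ext zero (suc ∘ nv)) (suc ∘ sv)) λ σ a N →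
      ⟦translate⟧ φ (ext σ tr) (ext zero (suc ∘ nv)) (suc ∘ sv) (NumeralsFor-ext {nv = nv} N numerals) sets
  ⟦translate⟧ (∃₂ φ)   tr nv sv numerals sets =
    ⟦∃ʰ⟧-set tr (translate φ (suc ∘ nv) (ext zero (suc ∘ sv))) λ σ S σ≗S →
      ⟦translate⟧ φ (ext σ tr) (suc ∘ nv) (ext zero (suc ∘ sv)) numerals (SetsFor-ext {sv = sv} σ≗S sets)
  ⟦translate⟧ (∀₂ φ)   tr nv sv numerals sets =
    ⟦∀ʰ⟧-set tr (translate φ (suc ∘ nv) (ext zero (suc ∘ sv))) λ σ S σ≗S →
      ⟦translate⟧ φ (ext σ tr) (suc ∘ nv) (ext zero (suc ∘ sv)) numerals (SetsFor-ext {sv = sv} σ≗S sets)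

2^k≡suc : ∀ k → suc (pred (2 ^ k)) ≡ 2 ^ k
2^k≡suc k = suc-pred (2 ^ k) {{m^n≢0 2 k}}

universal : (k : ℕ) → TS k
universal k = record
  { n     = pred (2 ^ k)
  ; E     = λ _ _ → true
  ; I     = λ _ → true
  ; ℓ     = λ u → Inverse.to 2↔Bool ∘ finToFun (cast (2^k≡suc k) u)
  ; total = λ u → u , refl
  }

Tr-universal : ∀ {k} (σ : Trace k) → Tr (universal k) σ
Tr-universal {k} σ = vertex , refl , (λ _ → refl) , label
  where
  open Inverse 2↔Bool using () renaming (to to bool; from to bit; strictlyInverseˡ to bool-bit)
  vertex : ℕ → Fin (suc (pred (2 ^ k)))
  vertex i = cast (sym (2^k≡suc k)) (funToFin (bit ∘ σ i))
  label : ∀ i p → σ i p ≡ TS.ℓ (universal k) (vertex i) p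
  label i p = sym (begin
    bool (finToFun (cast (2^k≡suc k) (vertex i)) p)
      ≡⟨ cong (λ u → bool (finToFun u p)) (cast-involutive (2^k≡suc k) (sym (2^k≡suc k)) _) ⟩
    bool (finToFun (funToFin (bit ∘ σ i)) p)
      ≡⟨ cong bool (finToFun-funToFin (bit ∘ σ i) p) ⟩
    bool (bit (σ i p))
      ≡⟨ bool-bit (σ i p) ⟩
    σ i p ∎)
    where open ≡-Reasoning

reduction : SOSentence → MCInstance
reduction φ = mc 3 (universal 3) (prenex (translate φ noVar noVar))

mainTheorem7 : Σ (SOSentence → MCInstance) λ f →
                   ExcludedMiddle 0ℓ → (φ : SOSentence) → TrueInN φ ⇔ Holds (f φ)
mainTheorem7 = reduction , λ em φ →
  let open Prenex em
      open Translation em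
      ψ = translate φ noVar noVar
  in ⇔-sym (⇔-trans (SatH⇔Satᴾ Tr-universal (prenex ψ) noVar)
           (⇔-trans (Satᴾ-prenex ψ noVar)
                    (⟦translate⟧ φ noVar noVar noVar (λ ()) (λ ()))))
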